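{- Let $n,p,q$ be positive integers and $c_1,\ldots,c_n,h_1,\ldots,h_p,e_1,\ldots,e_q$ indeterminates. If $n\le p+q$, then the ring homomorphism $\mathbb{Z}[c_1,\ldots,c_n]\to\mathbb{Z}[h_1,\ldots,h_p,e_1,\ldots,e_q]$ sending $c_k\mapsto\sum_{i+j=k}h_ie_j$ (with $h_0=e_0=1$, $h_i=0$ for $i>p$, $e_j=0$ for $j>q$) is injective. -}

module Defs where

open import Data.Nat using (ℕ; zero; suc; _<_; _≤_; _+_; _<?_)
open import Data.Fin using (Fin; toℕ)
open import Data.Sum using (_⊎_; inj₁; inj₂)
open import Relation.Nullary using (yes; no)
open import Level using (0ℓ)

-- The polynomial ring ℤ[X] over a set of indeterminates X, realised as
-- the free commutative ring on X: ring expressions over X modulo the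
-- congruence generated by the commutative-ring axioms.

infixl 6 _⊕_
infixl 7 _⊗_
infix 4 _≈_

data Poly (X : Set) : Set where
  var : X → Poly X
  𝟘 𝟙 : Poly X
  _⊕_ _⊗_ : Poly X → Poly X → Poly X
  ⊖_ : Poly X → Poly X

data _≈_ {X : Set} : Poly X → Poly X → Set where
  ≈-refl  : ∀ {a} → a ≈ a
  ≈-sym   : ∀ {a b} → a ≈ b → b ≈ a
  ≈-trans : ∀ {a b c} → a ≈ b → b ≈ c → a ≈ c
  ⊕-cong  : ∀ {a b c d} → a ≈ b → c ≈ d → a ⊕ c ≈ b ⊕ d
  ⊗-cong  : ∀ {a b c d} → a ≈ b → c ≈ d → a ⊗ c ≈ b ⊗ d
  ⊖-cong  : ∀ {a b} → a ≈ b → ⊖ a ≈ ⊖ b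
  ⊕-assoc : ∀ a b c → (a ⊕ b) ⊕ c ≈ a ⊕ (b ⊕ c)
  ⊕-comm  : ∀ a b → a ⊕ b ≈ b ⊕ a
  ⊕-idˡ   : ∀ a → 𝟘 ⊕ a ≈ a
  ⊖-invˡ  : ∀ a → (⊖ a) ⊕ a ≈ 𝟘
  ⊗-assoc : ∀ a b c → (a ⊗ b) ⊗ c ≈ a ⊗ (b ⊗ c)
  ⊗-comm  : ∀ a b → a ⊗ b ≈ b ⊗ a
  ⊗-idˡ   : ∀ a → 𝟙 ⊗ a ≈ a
  distribˡ : ∀ a b c → a ⊗ (b ⊕ c) ≈ (a ⊗ b) ⊕ (a ⊗ c)

subst : {X Y : Set} → (X → Poly Y) → Poly X → Poly Y
subst σ (var x) = σ x
subst σ 𝟘 = 𝟘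
subst σ 𝟙 = 𝟙
subst σ (a ⊕ b) = subst σ a ⊕ subst σ b
subst σ (a ⊗ b) = subst σ a ⊗ subst σ b
subst σ (⊖ a) = ⊖ subst σ a

-- Source ring ℤ[c₁,…,cₙ]: variable k : Fin n stands for c_{k+1}.
-- Target ring ℤ[h₁,…,h_p,e₁,…,e_q]: inj₁ i stands for h_{i+1},
-- inj₂ j stands for e_{j+1}.

HE : ℕ → ℕ → Set
HE p q = Fin p ⊎ Fin q

hh : (p q : ℕ) → ℕ → Poly (HE p q)
hh p q zero = 𝟙
hh p q (suc i) with i <? p
... | yes i<p = var (inj₁ (Data.Fin.fromℕ< i<p))
... | no  _   = 𝟘

ee : (p q : ℕ) → ℕ → Poly (HE p q)
ee p q zero = 𝟙
ee p q (suc j) with j <? q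
... | yes j<q = var (inj₂ (Data.Fin.fromℕ< j<q))
... | no  _   = 𝟘

-- Σ_{i+j=k} h_i e_j  =  Σ_{i=0}^{k} h_i e_{k-i}, via an auxiliary sum
-- conv i j = Σ_{a+b = i+j, a ≤ i} h_a e_b  (i.e. a from 0 to i, b = i+j-a).
conv : (p q : ℕ) → ℕ → ℕ → Poly (HE p q)
conv p q zero    j = hh p q zero ⊗ ee p q j
conv p q (suc i) j = conv p q i (suc j) ⊕ hh p q (suc i) ⊗ ee p q j

cimg : (p q k : ℕ) → Poly (HE p q)
cimg p q k = conv p q k 0

φ : (n p q : ℕ) → Poly (Fin n) → Poly (HE p q)
φ n p q = subst (λ k → cimg p q (suc (toℕ k)))

{-# OPTIONS --safe #-}
-- Evaluate at integer points.  Sending h_i and e_j to the elementary symmetric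
-- functions of two lists of integers xs and ys sends c_k to e_k(xs ++ ys); since
-- n ≤ p + q every list of n integers arises as xs ++ ys.  So it suffices that a
-- polynomial N(c_n, …, c_1) vanishing at (e_n(R), …, e_1(R)) for all R ∈ ℤⁿ is
-- zero.  Expand N in c_n = e_n: putting a zero root kills e_n and reduces the
-- remaining e_k to those of n - 1 roots, so the constant coefficient vanishes by
-- induction; the rest is then divisible by e_n and vanishes wherever all roots
-- are nonzero, hence everywhere, because a function that is polynomial in each
-- coordinate and vanishes off the coordinate hyperplanes vanishes identically.
module Submission where

open import Defs
open import Level using (0ℓ)
open import Algebra.Bundles using (CommutativeRing)
import Algebra.Properties.AbelianGroup as AbelianGroupProperties
import Tactic.RingSolver.Core.AlmostCommutativeRing as ACR
open import Data.Maybe using (nothing)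
open import Function using (_∘_; id)
open import Data.Empty using (⊥-elim)
open import Data.Unit using (⊤; tt)
open import Data.Product using (Σ; _,_; _×_)
open import Data.Sum using (inj₁; inj₂; [_,_]′)
open import Data.Nat as ℕ using (ℕ; zero; suc; _∸_; _<_; _≤_; _+_; s≤s; _<?_)
import Data.Nat.Properties as ℕ
open import Data.Fin using (Fin; zero; suc; toℕ; opposite)
import Data.Fin.Properties as Fin
open import Data.List using (List; []; _∷_; foldr; take; drop; length; _++_)
import Data.List.Properties as List
open import Data.Vec using (Vec; []; _∷_; toList)
import Data.Vec.Properties as Vec
open import Data.Vec.Relation.Unary.All using (All; []; _∷_)
open import Data.Integer as ℤ using (ℤ; +_; 0ℤ; 1ℤ; ∣_∣)
  renaming (_+_ to _+ᶻ_; _*_ to _*ᶻ_; -_ to -ᶻ_; _-_ to _-ᶻ_)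
import Data.Integer.Properties as ℤ
open import Data.Integer.Tactic.RingSolver using (solve-∀)
open import Relation.Nullary using (yes; no)
open import Relation.Binary.PropositionalEquality
  using (_≡_; _≢_; refl; cong; cong₂; sym; trans; module ≡-Reasoning)

open AbelianGroupProperties ℤ.+-0-abelianGroup using (inverseˡ-unique)

module PolyRing (X : Set) where

  commutativeRing : CommutativeRing 0ℓ 0ℓ
  commutativeRing = record
    { Carrier = Poly X ; _≈_ = _≈_ ; _+_ = _⊕_ ; _*_ = _⊗_ ; -_ = ⊖_ ; 0# = 𝟘 ; 1# = 𝟙
    ; isCommutativeRing = record
      { isRing = record
        { +-isAbelianGroup = record
          { isGroup = record
            { isMonoid = record
              { isSemigroup = record
                { isMagma = record
                  { isEquivalence = record { refl = ≈-refl ; sym = ≈-sym ; trans = ≈-trans }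
                  ; ∙-cong = ⊕-cong }
                ; assoc = ⊕-assoc }
              ; identity = ⊕-idˡ , λ a → ≈-trans (⊕-comm a 𝟘) (⊕-idˡ a) }
            ; inverse = ⊖-invˡ , λ a → ≈-trans (⊕-comm a (⊖ a)) (⊖-invˡ a)
            ; ⁻¹-cong = ⊖-cong }
          ; comm = ⊕-comm }
        ; *-cong = ⊗-cong
        ; *-assoc = ⊗-assoc
        ; *-identity = ⊗-idˡ , λ a → ≈-trans (⊗-comm a 𝟙) (⊗-idˡ a)
        ; distrib = distribˡ , λ a b c →
            ≈-trans (⊗-comm (b ⊕ c) a) (≈-trans (distribˡ a b c) (⊕-cong (⊗-comm a b) (⊗-comm a c)))
        }
      ; *-comm = ⊗-comm } }

  open CommutativeRing commutativeRing public
    using (setoid; zeroˡ; zeroʳ; +-identityʳ; *-identityʳ; distribʳ; -‿inverseʳ; +-abelianGroup)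
  open AbelianGroupProperties +-abelianGroup public using (x∙y⁻¹≈ε⇒x≈y; ε⁻¹≈ε; ⁻¹-∙-comm; ⁻¹-involutive)
  open import Algebra.Properties.Ring (CommutativeRing.ring commutativeRing) public
    using (-‿distribˡ-*; -‿distribʳ-*)
  -- The solver's coefficients are elements of Poly X, which it cannot compute with
  -- (it does not reduce (-1)(-1) to 1), so some ring identities are proved by hand.
  open import Tactic.RingSolver.NonReflective (ACR.fromCommutativeRing commutativeRing (λ _ → nothing)) public
    using (solve; _⊜_) renaming (_⊕_ to _:+_; _⊗_ to _:*_; ⊝_ to :-_)
  open import Relation.Binary.Reasoning.Setoid setoid public

subst-resp-≈ : {X Y : Set} (σ : X → Poly Y) {a b : Poly X} → a ≈ b → subst σ a ≈ subst σ b
subst-resp-≈ σ ≈-refl = ≈-refl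
subst-resp-≈ σ (≈-sym p) = ≈-sym (subst-resp-≈ σ p)
subst-resp-≈ σ (≈-trans p q) = ≈-trans (subst-resp-≈ σ p) (subst-resp-≈ σ q)
subst-resp-≈ σ (⊕-cong p q) = ⊕-cong (subst-resp-≈ σ p) (subst-resp-≈ σ q)
subst-resp-≈ σ (⊗-cong p q) = ⊗-cong (subst-resp-≈ σ p) (subst-resp-≈ σ q)
subst-resp-≈ σ (⊖-cong p) = ⊖-cong (subst-resp-≈ σ p)
subst-resp-≈ σ (⊕-assoc a b c) = ⊕-assoc _ _ _
subst-resp-≈ σ (⊕-comm a b) = ⊕-comm _ _
subst-resp-≈ σ (⊕-idˡ a) = ⊕-idˡ _
subst-resp-≈ σ (⊖-invˡ a) = ⊖-invˡ _
subst-resp-≈ σ (⊗-assoc a b c) = ⊗-assoc _ _ _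
subst-resp-≈ σ (⊗-comm a b) = ⊗-comm _ _
subst-resp-≈ σ (⊗-idˡ a) = ⊗-idˡ _
subst-resp-≈ σ (distribˡ a b c) = distribˡ _ _ _

eval : {X : Set} → (X → ℤ) → Poly X → ℤ
eval v (var x) = v x
eval v 𝟘 = 0ℤ
eval v 𝟙 = 1ℤ
eval v (a ⊕ b) = eval v a +ᶻ eval v b
eval v (a ⊗ b) = eval v a *ᶻ eval v b
eval v (⊖ a) = -ᶻ eval v a

eval-resp-≈ : {X : Set} (v : X → ℤ) {a b : Poly X} → a ≈ b → eval v a ≡ eval v b
eval-resp-≈ v ≈-refl = refl
eval-resp-≈ v (≈-sym p) = sym (eval-resp-≈ v p)
eval-resp-≈ v (≈-trans p q) = trans (eval-resp-≈ v p) (eval-resp-≈ v q)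
eval-resp-≈ v (⊕-cong p q) = cong₂ _+ᶻ_ (eval-resp-≈ v p) (eval-resp-≈ v q)
eval-resp-≈ v (⊗-cong p q) = cong₂ _*ᶻ_ (eval-resp-≈ v p) (eval-resp-≈ v q)
eval-resp-≈ v (⊖-cong p) = cong -ᶻ_ (eval-resp-≈ v p)
eval-resp-≈ v (⊕-assoc a b c) = ℤ.+-assoc (eval v a) (eval v b) (eval v c)
eval-resp-≈ v (⊕-comm a b) = ℤ.+-comm (eval v a) (eval v b)
eval-resp-≈ v (⊕-idˡ a) = ℤ.+-identityˡ (eval v a)
eval-resp-≈ v (⊖-invˡ a) = ℤ.+-inverseˡ (eval v a)
eval-resp-≈ v (⊗-assoc a b c) = ℤ.*-assoc (eval v a) (eval v b) (eval v c)
eval-resp-≈ v (⊗-comm a b) = ℤ.*-comm (eval v a) (eval v b)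
eval-resp-≈ v (⊗-idˡ a) = ℤ.*-identityˡ (eval v a)
eval-resp-≈ v (distribˡ a b c) = ℤ.*-distribˡ-+ (eval v a) (eval v b) (eval v c)

eval-cong : {X : Set} {v w : X → ℤ} → (∀ x → v x ≡ w x) → ∀ a → eval v a ≡ eval w a
eval-cong v≗w (var x) = v≗w x
eval-cong v≗w 𝟘 = refl
eval-cong v≗w 𝟙 = refl
eval-cong v≗w (a ⊕ b) = cong₂ _+ᶻ_ (eval-cong v≗w a) (eval-cong v≗w b)
eval-cong v≗w (a ⊗ b) = cong₂ _*ᶻ_ (eval-cong v≗w a) (eval-cong v≗w b)
eval-cong v≗w (⊖ a) = cong -ᶻ_ (eval-cong v≗w a)

eval-subst : {X Y : Set} (σ : X → Poly Y) (v : Y → ℤ) (a : Poly X) →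
             eval v (subst σ a) ≡ eval (λ x → eval v (σ x)) a
eval-subst σ v (var x) = refl
eval-subst σ v 𝟘 = refl
eval-subst σ v 𝟙 = refl
eval-subst σ v (a ⊕ b) = cong₂ _+ᶻ_ (eval-subst σ v a) (eval-subst σ v b)
eval-subst σ v (a ⊗ b) = cong₂ _*ᶻ_ (eval-subst σ v a) (eval-subst σ v b)
eval-subst σ v (⊖ a) = cong -ᶻ_ (eval-subst σ v a)

module Closed where
  open PolyRing (Fin 0)

  nat : ℕ → Poly (Fin 0)
  nat zero = 𝟘
  nat (suc k) = 𝟙 ⊕ nat k

  nat-+ : ∀ a b → nat (a + b) ≈ nat a ⊕ nat b
  nat-+ zero b = ≈-sym (⊕-idˡ _)
  nat-+ (suc a) b = ≈-trans (⊕-cong ≈-refl (nat-+ a b)) (≈-sym (⊕-assoc _ _ _))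

  nat-* : ∀ a b → nat (a ℕ.* b) ≈ nat a ⊗ nat b
  nat-* zero b = ≈-sym (zeroˡ _)
  nat-* (suc a) b =
    ≈-trans (nat-+ b (a ℕ.* b)) (≈-trans (⊕-cong (≈-sym (⊗-idˡ _)) (nat-* a b)) (≈-sym (distribʳ _ _ _)))

  ⟦_⟧ : ℕ × ℕ → Poly (Fin 0)
  ⟦ a , b ⟧ = nat a ⊕ ⊖ nat b

  _⊞_ _⊠_ : ℕ × ℕ → ℕ × ℕ → ℕ × ℕ
  (a , b) ⊞ (c , d) = (a + c , b + d)
  (a , b) ⊠ (c , d) = (a ℕ.* c + b ℕ.* d , a ℕ.* d + b ℕ.* c)

  ⊟_ : ℕ × ℕ → ℕ × ℕ
  ⊟ (a , b) = (b , a)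

  normal : Poly (Fin 0) → ℕ × ℕ
  normal (var ())
  normal 𝟘 = (0 , 0)
  normal 𝟙 = (1 , 0)
  normal (x ⊕ y) = normal x ⊞ normal y
  normal (x ⊗ y) = normal x ⊠ normal y
  normal (⊖ x) = ⊟ normal x

  ⟦⊞⟧ : ∀ u w → ⟦ u ⊞ w ⟧ ≈ ⟦ u ⟧ ⊕ ⟦ w ⟧
  ⟦⊞⟧ (a , b) (c , d) = begin
      nat (a + c) ⊕ ⊖ nat (b + d)
    ≈⟨ ⊕-cong (nat-+ a c) (⊖-cong (nat-+ b d)) ⟩
      (nat a ⊕ nat c) ⊕ ⊖ (nat b ⊕ nat d)
    ≈⟨ solve 4 (λ a b c d → ((a :+ c) :+ (:- (b :+ d))) ⊜ ((a :+ (:- b)) :+ (c :+ (:- d))))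
             ≈-refl (nat a) (nat b) (nat c) (nat d) ⟩
      ⟦ a , b ⟧ ⊕ ⟦ c , d ⟧ ∎

  neg-*-neg : ∀ x y → ⊖ x ⊗ ⊖ y ≈ x ⊗ y
  neg-*-neg x y =
    ≈-trans (≈-sym (-‿distribˡ-* x (⊖ y))) (≈-trans (⊖-cong (≈-sym (-‿distribʳ-* x y))) (⁻¹-involutive _))

  ⟦⊠⟧ : ∀ u w → ⟦ u ⊠ w ⟧ ≈ ⟦ u ⟧ ⊗ ⟦ w ⟧
  ⟦⊠⟧ (a , b) (c , d) = begin
      nat (a ℕ.* c + b ℕ.* d) ⊕ ⊖ nat (a ℕ.* d + b ℕ.* c)
    ≈⟨ ⊕-cong (≈-trans (nat-+ _ _) (⊕-cong (nat-* a c) (nat-* b d)))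
              (⊖-cong (≈-trans (nat-+ _ _) (⊕-cong (nat-* a d) (nat-* b c)))) ⟩
      (A ⊗ C ⊕ B ⊗ D) ⊕ ⊖ (A ⊗ D ⊕ B ⊗ C)
    ≈⟨ ⊕-cong (⊕-cong ≈-refl (≈-sym (neg-*-neg B D)))
              (≈-trans (≈-sym (⁻¹-∙-comm _ _)) (⊕-cong (-‿distribʳ-* A D) (-‿distribˡ-* B C))) ⟩
      (A ⊗ C ⊕ ⊖ B ⊗ ⊖ D) ⊕ (A ⊗ ⊖ D ⊕ ⊖ B ⊗ C)
    ≈⟨ solve 4 (λ a b c d → ((a :* c :+ b :* d) :+ (a :* d :+ b :* c)) ⊜ ((a :+ b) :* (c :+ d)))
             ≈-refl A (⊖ B) C (⊖ D) ⟩
      ⟦ a , b ⟧ ⊗ ⟦ c , d ⟧ ∎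
    where A = nat a; B = nat b; C = nat c; D = nat d

  ⟦⊟⟧ : ∀ u → ⟦ ⊟ u ⟧ ≈ ⊖ ⟦ u ⟧
  ⟦⊟⟧ (a , b) = begin
      nat b ⊕ ⊖ nat a      ≈⟨ ⊕-comm _ _ ⟩
      ⊖ nat a ⊕ nat b      ≈⟨ ⊕-cong ≈-refl (⁻¹-involutive _) ⟨
      ⊖ nat a ⊕ ⊖ ⊖ nat b  ≈⟨ ⁻¹-∙-comm _ _ ⟩
      ⊖ ⟦ a , b ⟧          ∎

  normal-sound : ∀ N → N ≈ ⟦ normal N ⟧
  normal-sound (var ())
  normal-sound 𝟘 = ≈-sym (-‿inverseʳ 𝟘)
  normal-sound 𝟙 = ≈-sym (≈-trans (⊕-cong (+-identityʳ 𝟙) ε⁻¹≈ε) (+-identityʳ 𝟙))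
  normal-sound (x ⊕ y) = ≈-trans (⊕-cong (normal-sound x) (normal-sound y)) (≈-sym (⟦⊞⟧ (normal x) (normal y)))
  normal-sound (x ⊗ y) = ≈-trans (⊗-cong (normal-sound x) (normal-sound y)) (≈-sym (⟦⊠⟧ (normal x) (normal y)))
  normal-sound (⊖ x) = ≈-trans (⊖-cong (normal-sound x)) (≈-sym (⟦⊟⟧ (normal x)))

  ⟦_⟧ℤ : ℕ × ℕ → ℤ
  ⟦ a , b ⟧ℤ = + a -ᶻ + b

  ⟦⊞⟧ℤ : ∀ u w → ⟦ u ⟧ℤ +ᶻ ⟦ w ⟧ℤ ≡ ⟦ u ⊞ w ⟧ℤ
  ⟦⊞⟧ℤ (a , b) (c , d) =
    trans (difference-+ (+ a) (+ b) (+ c) (+ d)) (sym (cong₂ _-ᶻ_ (ℤ.pos-+ a c) (ℤ.pos-+ b d)))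
    where
    difference-+ : ∀ a b c d → (a -ᶻ b) +ᶻ (c -ᶻ d) ≡ (a +ᶻ c) -ᶻ (b +ᶻ d)
    difference-+ = solve-∀

  ⟦⊠⟧ℤ : ∀ u w → ⟦ u ⟧ℤ *ᶻ ⟦ w ⟧ℤ ≡ ⟦ u ⊠ w ⟧ℤ
  ⟦⊠⟧ℤ (a , b) (c , d) =
    trans (difference-* (+ a) (+ b) (+ c) (+ d))
          (sym (cong₂ _-ᶻ_ (trans (ℤ.pos-+ (a ℕ.* c) (b ℕ.* d)) (cong₂ _+ᶻ_ (ℤ.pos-* a c) (ℤ.pos-* b d)))
                           (trans (ℤ.pos-+ (a ℕ.* d) (b ℕ.* c)) (cong₂ _+ᶻ_ (ℤ.pos-* a d) (ℤ.pos-* b c)))))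
    where
    difference-* : ∀ a b c d → (a -ᶻ b) *ᶻ (c -ᶻ d) ≡ (a *ᶻ c +ᶻ b *ᶻ d) -ᶻ (a *ᶻ d +ᶻ b *ᶻ c)
    difference-* = solve-∀

  ⟦⊟⟧ℤ : ∀ u → -ᶻ ⟦ u ⟧ℤ ≡ ⟦ ⊟ u ⟧ℤ
  ⟦⊟⟧ℤ (a , b) = difference-neg (+ a) (+ b)
    where
    difference-neg : ∀ a b → -ᶻ (a -ᶻ b) ≡ b -ᶻ a
    difference-neg = solve-∀

  eval-normal : (v : Fin 0 → ℤ) → ∀ N → eval v N ≡ ⟦ normal N ⟧ℤ
  eval-normal v (var ())
  eval-normal v 𝟘 = refl
  eval-normal v 𝟙 = refl
  eval-normal v (x ⊕ y) = trans (cong₂ _+ᶻ_ (eval-normal v x) (eval-normal v y)) (⟦⊞⟧ℤ (normal x) (normal y))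
  eval-normal v (x ⊗ y) = trans (cong₂ _*ᶻ_ (eval-normal v x) (eval-normal v y)) (⟦⊠⟧ℤ (normal x) (normal y))
  eval-normal v (⊖ x) = trans (cong -ᶻ_ (eval-normal v x)) (⟦⊟⟧ℤ (normal x))

  ⟦diagonal⟧ : ∀ {a b} → a ≡ b → ⟦ a , b ⟧ ≈ 𝟘
  ⟦diagonal⟧ refl = -‿inverseʳ _

  eval≡0⇒≈𝟘 : (v : Fin 0 → ℤ) → ∀ N → eval v N ≡ 0ℤ → N ≈ 𝟘
  eval≡0⇒≈𝟘 v N eval≡0 = ≈-trans (normal-sound N)
    (⟦diagonal⟧ (ℤ.+-injective (ℤ.i-j≡0⇒i≡j _ _ (trans (sym (eval-normal v N)) eval≡0))))

module Horner {m : ℕ} where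
  open PolyRing (Fin (suc m))

  weaken : Poly (Fin m) → Poly (Fin (suc m))
  weaken = subst (λ j → var (suc j))

  ⟦_⟧ₕ : List (Poly (Fin m)) → Poly (Fin (suc m))
  ⟦ [] ⟧ₕ = 𝟘
  ⟦ a ∷ as ⟧ₕ = weaken a ⊕ var zero ⊗ ⟦ as ⟧ₕ

  _+ₕ_ _*ₕ_ : List (Poly (Fin m)) → List (Poly (Fin m)) → List (Poly (Fin m))
  [] +ₕ bs = bs
  (a ∷ as) +ₕ [] = a ∷ as
  (a ∷ as) +ₕ (b ∷ bs) = (a ⊕ b) ∷ (as +ₕ bs)

  _·ₕ_ : Poly (Fin m) → List (Poly (Fin m)) → List (Poly (Fin m))
  a ·ₕ [] = []
  a ·ₕ (b ∷ bs) = (a ⊗ b) ∷ (a ·ₕ bs)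

  [] *ₕ bs = []
  (a ∷ as) *ₕ bs = (a ·ₕ bs) +ₕ (𝟘 ∷ (as *ₕ bs))

  -ₕ_ : List (Poly (Fin m)) → List (Poly (Fin m))
  -ₕ [] = []
  -ₕ (a ∷ as) = (⊖ a) ∷ (-ₕ as)

  horner : Poly (Fin (suc m)) → List (Poly (Fin m))
  horner (var zero) = 𝟘 ∷ 𝟙 ∷ []
  horner (var (suc j)) = var j ∷ []
  horner 𝟘 = []
  horner 𝟙 = 𝟙 ∷ []
  horner (a ⊕ b) = horner a +ₕ horner b
  horner (a ⊗ b) = horner a *ₕ horner b
  horner (⊖ a) = -ₕ horner a

  +ₕ-sound : ∀ as bs → ⟦ as +ₕ bs ⟧ₕ ≈ ⟦ as ⟧ₕ ⊕ ⟦ bs ⟧ₕ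
  +ₕ-sound [] bs = ≈-sym (⊕-idˡ _)
  +ₕ-sound (a ∷ as) [] = ≈-sym (+-identityʳ _)
  +ₕ-sound (a ∷ as) (b ∷ bs) = begin
      (weaken a ⊕ weaken b) ⊕ var zero ⊗ ⟦ as +ₕ bs ⟧ₕ
    ≈⟨ ⊕-cong ≈-refl (⊗-cong ≈-refl (+ₕ-sound as bs)) ⟩
      (weaken a ⊕ weaken b) ⊕ var zero ⊗ (⟦ as ⟧ₕ ⊕ ⟦ bs ⟧ₕ)
    ≈⟨ solve 5 (λ a b x s t → ((a :+ b) :+ x :* (s :+ t)) ⊜ ((a :+ x :* s) :+ (b :+ x :* t)))
             ≈-refl (weaken a) (weaken b) (var zero) ⟦ as ⟧ₕ ⟦ bs ⟧ₕ ⟩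
      ⟦ a ∷ as ⟧ₕ ⊕ ⟦ b ∷ bs ⟧ₕ ∎

  ·ₕ-sound : ∀ a bs → ⟦ a ·ₕ bs ⟧ₕ ≈ weaken a ⊗ ⟦ bs ⟧ₕ
  ·ₕ-sound a [] = ≈-sym (zeroʳ _)
  ·ₕ-sound a (b ∷ bs) = begin
      weaken a ⊗ weaken b ⊕ var zero ⊗ ⟦ a ·ₕ bs ⟧ₕ
    ≈⟨ ⊕-cong ≈-refl (⊗-cong ≈-refl (·ₕ-sound a bs)) ⟩
      weaken a ⊗ weaken b ⊕ var zero ⊗ (weaken a ⊗ ⟦ bs ⟧ₕ)
    ≈⟨ solve 4 (λ a b x t → (a :* b :+ x :* (a :* t)) ⊜ (a :* (b :+ x :* t)))
             ≈-refl (weaken a) (weaken b) (var zero) ⟦ bs ⟧ₕ ⟩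
      weaken a ⊗ ⟦ b ∷ bs ⟧ₕ ∎

  *ₕ-sound : ∀ as bs → ⟦ as *ₕ bs ⟧ₕ ≈ ⟦ as ⟧ₕ ⊗ ⟦ bs ⟧ₕ
  *ₕ-sound [] bs = ≈-sym (zeroˡ _)
  *ₕ-sound (a ∷ as) bs = begin
      ⟦ (a ·ₕ bs) +ₕ (𝟘 ∷ (as *ₕ bs)) ⟧ₕ
    ≈⟨ +ₕ-sound (a ·ₕ bs) (𝟘 ∷ (as *ₕ bs)) ⟩
      ⟦ a ·ₕ bs ⟧ₕ ⊕ (𝟘 ⊕ var zero ⊗ ⟦ as *ₕ bs ⟧ₕ)
    ≈⟨ ⊕-cong (·ₕ-sound a bs) (≈-trans (⊕-idˡ _) (⊗-cong ≈-refl (*ₕ-sound as bs))) ⟩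
      weaken a ⊗ ⟦ bs ⟧ₕ ⊕ var zero ⊗ (⟦ as ⟧ₕ ⊗ ⟦ bs ⟧ₕ)
    ≈⟨ ≈-sym (≈-trans (distribʳ _ _ _) (⊕-cong ≈-refl (⊗-assoc _ _ _))) ⟩
      ⟦ a ∷ as ⟧ₕ ⊗ ⟦ bs ⟧ₕ ∎

  -ₕ-sound : ∀ as → ⟦ -ₕ as ⟧ₕ ≈ ⊖ ⟦ as ⟧ₕ
  -ₕ-sound [] = ≈-sym ε⁻¹≈ε
  -ₕ-sound (a ∷ as) = begin
      ⊖ weaken a ⊕ var zero ⊗ ⟦ -ₕ as ⟧ₕ
    ≈⟨ ⊕-cong ≈-refl (≈-trans (⊗-cong ≈-refl (-ₕ-sound as)) (≈-sym (-‿distribʳ-* _ _))) ⟩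
      ⊖ weaken a ⊕ ⊖ (var zero ⊗ ⟦ as ⟧ₕ)
    ≈⟨ ⁻¹-∙-comm _ _ ⟩
      ⊖ ⟦ a ∷ as ⟧ₕ ∎

  horner-sound : ∀ N → N ≈ ⟦ horner N ⟧ₕ
  horner-sound (var zero) =
    ≈-sym (≈-trans (⊕-idˡ _) (≈-trans (⊗-cong ≈-refl (≈-sym (horner-sound 𝟙))) (*-identityʳ _)))
  horner-sound (var (suc j)) = ≈-sym (≈-trans (⊕-cong ≈-refl (zeroʳ _)) (+-identityʳ _))
  horner-sound 𝟘 = ≈-refl
  horner-sound 𝟙 = ≈-sym (≈-trans (⊕-cong ≈-refl (zeroʳ _)) (+-identityʳ _))
  horner-sound (a ⊕ b) = ≈-trans (⊕-cong (horner-sound a) (horner-sound b)) (≈-sym (+ₕ-sound (horner a) (horner b)))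
  horner-sound (a ⊗ b) = ≈-trans (⊗-cong (horner-sound a) (horner-sound b)) (≈-sym (*ₕ-sound (horner a) (horner b)))
  horner-sound (⊖ a) = ≈-trans (⊖-cong (horner-sound a)) (≈-sym (-ₕ-sound (horner a)))

HasDifferenceQuotient : (ℤ → ℤ) → Set
HasDifferenceQuotient f = Σ (ℤ → ℤ) λ g → ∀ x → f x ≡ f 0ℤ +ᶻ x *ᶻ g x

dq-const : ∀ c → HasDifferenceQuotient (λ _ → c)
dq-const c = (λ _ → 0ℤ) , λ x → sym (trans (cong (c +ᶻ_) (ℤ.*-zeroʳ x)) (ℤ.+-identityʳ c))

dq-id : HasDifferenceQuotient (λ x → x)
dq-id = (λ _ → 1ℤ) , λ x → sym (trans (ℤ.+-identityˡ _) (ℤ.*-identityʳ x))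

dq-+ : ∀ {f g} → HasDifferenceQuotient f → HasDifferenceQuotient g →
       HasDifferenceQuotient (λ x → f x +ᶻ g x)
dq-+ {f} {g} (f′ , f≡) (g′ , g≡) =
  (λ x → f′ x +ᶻ g′ x) , λ x → trans (cong₂ _+ᶻ_ (f≡ x) (g≡ x)) (expand (f 0ℤ) (g 0ℤ) x (f′ x) (g′ x))
  where
  expand : ∀ a b x s t → (a +ᶻ x *ᶻ s) +ᶻ (b +ᶻ x *ᶻ t) ≡ (a +ᶻ b) +ᶻ x *ᶻ (s +ᶻ t)
  expand = solve-∀

dq-* : ∀ {f g} → HasDifferenceQuotient f → HasDifferenceQuotient g →
       HasDifferenceQuotient (λ x → f x *ᶻ g x)
dq-* {f} {g} (f′ , f≡) (g′ , g≡) =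
  (λ x → f 0ℤ *ᶻ g′ x +ᶻ f′ x *ᶻ g 0ℤ +ᶻ x *ᶻ f′ x *ᶻ g′ x) ,
  λ x → trans (cong₂ _*ᶻ_ (f≡ x) (g≡ x)) (expand (f 0ℤ) (g 0ℤ) x (f′ x) (g′ x))
  where
  expand : ∀ a b x s t → (a +ᶻ x *ᶻ s) *ᶻ (b +ᶻ x *ᶻ t) ≡ a *ᶻ b +ᶻ x *ᶻ (a *ᶻ t +ᶻ s *ᶻ b +ᶻ x *ᶻ s *ᶻ t)
  expand = solve-∀

dq-neg : ∀ {f} → HasDifferenceQuotient f → HasDifferenceQuotient (λ x → -ᶻ f x)
dq-neg {f} (f′ , f≡) = (λ x → -ᶻ f′ x) , λ x → trans (cong -ᶻ_ (f≡ x)) (expand (f 0ℤ) x (f′ x))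
  where
  expand : ∀ a x s → -ᶻ (a +ᶻ x *ᶻ s) ≡ -ᶻ a +ᶻ x *ᶻ -ᶻ s
  expand = solve-∀

m≡[1+m]*k⇒m≡0 : ∀ m k → m ≡ suc m ℕ.* k → m ≡ 0
m≡[1+m]*k⇒m≡0 m zero m≡0 = trans m≡0 (ℕ.*-zeroʳ (suc m))
m≡[1+m]*k⇒m≡0 m (suc k) m≡ = ⊥-elim (ℕ.<-irrefl m≡ (ℕ.m≤m*n (suc m) (suc k)))

-- Evaluating at y = 1 + ∣f 0∣ shows that y divides f 0, which forces f 0 = 0.
dq-vanishing : ∀ {f} → HasDifferenceQuotient f → (∀ y → y ≢ 0ℤ → f y ≡ 0ℤ) → f 0ℤ ≡ 0ℤ
dq-vanishing {f} (f′ , f≡) vanishes = ℤ.∣i∣≡0⇒i≡0 (m≡[1+m]*k⇒m≡0 _ _ ∣f0∣≡y*∣f′y∣)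
  where
  open ≡-Reasoning
  y = + suc ∣ f 0ℤ ∣
  ∣f0∣≡y*∣f′y∣ : ∣ f 0ℤ ∣ ≡ suc ∣ f 0ℤ ∣ ℕ.* ∣ f′ y ∣
  ∣f0∣≡y*∣f′y∣ = begin
    ∣ f 0ℤ ∣            ≡⟨ cong ∣_∣ (inverseˡ-unique (f 0ℤ) (y *ᶻ f′ y) (trans (sym (f≡ y)) (vanishes y λ ()))) ⟩
    ∣ -ᶻ (y *ᶻ f′ y) ∣  ≡⟨ ℤ.∣-i∣≡∣i∣ (y *ᶻ f′ y) ⟩
    ∣ y *ᶻ f′ y ∣       ≡⟨ ℤ.abs-* y (f′ y) ⟩
    suc ∣ f 0ℤ ∣ ℕ.* ∣ f′ y ∣ ∎

HasDifferenceQuotients : ∀ n → (Vec ℤ n → ℤ) → Set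
HasDifferenceQuotients zero F = ⊤
HasDifferenceQuotients (suc n) F =
  (∀ R → HasDifferenceQuotient (λ x → F (x ∷ R))) × (∀ x → HasDifferenceQuotients n (λ R → F (x ∷ R)))

dqs-const : ∀ n c → HasDifferenceQuotients n (λ _ → c)
dqs-const zero c = tt
dqs-const (suc n) c = (λ _ → dq-const c) , λ _ → dqs-const n c

dqs-zipWith : (_∙_ : ℤ → ℤ → ℤ) →
              (∀ {f g} → HasDifferenceQuotient f → HasDifferenceQuotient g →
                         HasDifferenceQuotient (λ x → f x ∙ g x)) →
              ∀ n {F G} → HasDifferenceQuotients n F → HasDifferenceQuotients n G →
              HasDifferenceQuotients n (λ R → F R ∙ G R)
dqs-zipWith _∙_ dq-∙ zero _ _ = tt
dqs-zipWith _∙_ dq-∙ (suc n) (F₀ , F₊) (G₀ , G₊) =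
  (λ R → dq-∙ (F₀ R) (G₀ R)) , λ x → dqs-zipWith _∙_ dq-∙ n (F₊ x) (G₊ x)

dqs-neg : ∀ n {F} → HasDifferenceQuotients n F → HasDifferenceQuotients n (λ R → -ᶻ F R)
dqs-neg zero _ = tt
dqs-neg (suc n) (F₀ , F₊) = (λ R → dq-neg (F₀ R)) , λ x → dqs-neg n (F₊ x)

dqs-eval : ∀ {Y : Set} n (Q : Poly Y) (F : Y → Vec ℤ n → ℤ) → (∀ y → HasDifferenceQuotients n (F y)) →
           HasDifferenceQuotients n (λ R → eval (λ y → F y R) Q)
dqs-eval n (var y) F dqs = dqs y
dqs-eval n 𝟘 F dqs = dqs-const n 0ℤ
dqs-eval n 𝟙 F dqs = dqs-const n 1ℤ
dqs-eval n (a ⊕ b) F dqs = dqs-zipWith _+ᶻ_ dq-+ n (dqs-eval n a F dqs) (dqs-eval n b F dqs)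
dqs-eval n (a ⊗ b) F dqs = dqs-zipWith _*ᶻ_ dq-* n (dqs-eval n a F dqs) (dqs-eval n b F dqs)
dqs-eval n (⊖ a) F dqs = dqs-neg n (dqs-eval n a F dqs)

dqs-vanishing : ∀ n {F} → HasDifferenceQuotients n F →
                (∀ R → All (_≢ 0ℤ) R → F R ≡ 0ℤ) → ∀ R → F R ≡ 0ℤ
dqs-vanishing zero _ vanishes [] = vanishes [] []
dqs-vanishing (suc n) {F} (F₀ , F₊) vanishes (x ∷ R) = vanishes-at x
  where
  off-hyperplane : ∀ x → x ≢ 0ℤ → ∀ R → F (x ∷ R) ≡ 0ℤ
  off-hyperplane x x≢0 = dqs-vanishing n (F₊ x) λ R R≢0 → vanishes (x ∷ R) (x≢0 ∷ R≢0)
  vanishes-at : ∀ x → F (x ∷ R) ≡ 0ℤ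
  vanishes-at x with x ℤ.≟ 0ℤ
  ... | no x≢0 = off-hyperplane x x≢0 R
  ... | yes refl = dq-vanishing (F₀ R) λ y y≢0 → off-hyperplane y y≢0 R

infixr 5 _▸_

-- Coefficient sequences: x ▸ A is that of (1 + x t) A(t), so esym xs k is the
-- coefficient of t^k in ∏_{x ∈ xs} (1 + x t), the k-th elementary symmetric function.
_▸_ : ℤ → (ℕ → ℤ) → ℕ → ℤ
(x ▸ A) zero = A zero
(x ▸ A) (suc k) = A (suc k) +ᶻ x *ᶻ A k

δ : ℕ → ℤ
δ zero = 1ℤ
δ (suc _) = 0ℤ

esym : List ℤ → ℕ → ℤ
esym = foldr _▸_ δ

esym-zero : ∀ xs → esym xs 0 ≡ 1ℤ
esym-zero [] = refl
esym-zero (x ∷ xs) = esym-zero xs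

esym-beyond : ∀ xs {k} → length xs < k → esym xs k ≡ 0ℤ
esym-beyond [] {suc k} _ = refl
esym-beyond (x ∷ xs) {suc k} (s≤s |xs|<k) = begin
    esym xs (suc k) +ᶻ x *ᶻ esym xs k
  ≡⟨ cong₂ (λ u v → u +ᶻ x *ᶻ v) (esym-beyond xs (ℕ.m<n⇒m<1+n |xs|<k)) (esym-beyond xs |xs|<k) ⟩
    0ℤ +ᶻ x *ᶻ 0ℤ
  ≡⟨ cong (0ℤ +ᶻ_) (ℤ.*-zeroʳ x) ⟩
    0ℤ ∎
  where open ≡-Reasoning

esym-0∷ : ∀ xs k → esym (0ℤ ∷ xs) k ≡ esym xs k
esym-0∷ xs zero = refl
esym-0∷ xs (suc k) = ℤ.+-identityʳ _

esym-top≢0 : ∀ {n} (R : Vec ℤ n) → All (_≢ 0ℤ) R → esym (toList R) n ≢ 0ℤ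
esym-top≢0 [] [] ()
esym-top≢0 {suc n} (x ∷ R) (x≢0 ∷ R≢0) top≡0 =
  [ x≢0 , esym-top≢0 R R≢0 ]′ (ℤ.i*j≡0⇒i≡0∨j≡0 x x*top≡0)
  where
  x*top≡0 : x *ᶻ esym (toList R) n ≡ 0ℤ
  x*top≡0 = trans (sym (ℤ.+-identityˡ _))
    (trans (cong (_+ᶻ x *ᶻ esym (toList R) n) (sym (esym-beyond (toList R) (s≤s (ℕ.≤-reflexive (Vec.length-toList R))))))
           top≡0)

dqs-esym : ∀ n k → HasDifferenceQuotients n (λ R → esym (toList R) k)
dqs-esym zero k = tt
dqs-esym (suc n) zero = (λ R → dq-const _) , λ _ → dqs-esym n zero
dqs-esym (suc n) (suc k) =
  (λ R → dq-+ (dq-const (esym (toList R) (suc k))) (dq-* dq-id (dq-const (esym (toList R) k)))) ,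
  λ x → dqs-zipWith _+ᶻ_ dq-+ n (dqs-esym n (suc k)) (dqs-zipWith _*ᶻ_ dq-* n (dqs-const n x) (dqs-esym n k))

-- convolve A B i j = Σ_{a ≤ i} A a · B (i + j - a), the pattern of conv in Defs.
convolve : (ℕ → ℤ) → (ℕ → ℤ) → ℕ → ℕ → ℤ
convolve A B zero j = A zero *ᶻ B j
convolve A B (suc i) j = convolve A B i (suc j) +ᶻ A (suc i) *ᶻ B j

convolve-δ : ∀ B i j → convolve δ B i j ≡ B (i + j)
convolve-δ B zero j = ℤ.*-identityˡ (B j)
convolve-δ B (suc i) j = trans (ℤ.+-identityʳ _) (trans (convolve-δ B i (suc j)) (cong B (ℕ.+-suc i j)))

convolve-▸ : ∀ x A B i j →
             convolve (x ▸ A) B (suc i) j ≡ convolve A B (suc i) j +ᶻ x *ᶻ convolve A B i j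
convolve-▸ x A B zero j = expand (A 0) (A 1) x (B j) (B (suc j))
  where
  expand : ∀ a₀ a₁ x b₀ b₁ → a₀ *ᶻ b₁ +ᶻ (a₁ +ᶻ x *ᶻ a₀) *ᶻ b₀ ≡ (a₀ *ᶻ b₁ +ᶻ a₁ *ᶻ b₀) +ᶻ x *ᶻ (a₀ *ᶻ b₀)
  expand = solve-∀
convolve-▸ x A B (suc i) j =
  trans (cong (_+ᶻ (x ▸ A) (suc (suc i)) *ᶻ B j) (convolve-▸ x A B i (suc j)))
        (regroup (convolve A B (suc i) (suc j)) (convolve A B i (suc j)) x (A (suc (suc i))) (A (suc i)) (B j))
  where
  regroup : ∀ s₁ s₀ x a₂ a₁ b → (s₁ +ᶻ x *ᶻ s₀) +ᶻ (a₂ +ᶻ x *ᶻ a₁) *ᶻ b ≡ (s₁ +ᶻ a₂ *ᶻ b) +ᶻ x *ᶻ (s₀ +ᶻ a₁ *ᶻ b)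
  regroup = solve-∀

convolve-esym : ∀ xs B k → convolve (esym xs) B k 0 ≡ foldr _▸_ B xs k
convolve-esym [] B k = trans (convolve-δ B k 0) (cong B (ℕ.+-identityʳ k))
convolve-esym (x ∷ xs) B zero = convolve-esym xs B zero
convolve-esym (x ∷ xs) B (suc k) =
  trans (convolve-▸ x (esym xs) B k 0)
        (cong₂ (λ u v → u +ᶻ x *ᶻ v) (convolve-esym xs B (suc k)) (convolve-esym xs B k))

esym-++ : ∀ xs ys k → esym (xs ++ ys) k ≡ convolve (esym xs) (esym ys) k 0
esym-++ xs ys k = trans (cong (λ A → A k) (List.foldr-++ _▸_ δ xs ys)) (sym (convolve-esym xs (esym ys) k))

esyms esymsᵒᵖ : ∀ {n} → Vec ℤ n → Fin n → ℤ
esyms R k = esym (toList R) (suc (toℕ k))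
esymsᵒᵖ {n} R k = esym (toList R) (n ∸ toℕ k)

EsymsIndependent : ℕ → Set
EsymsIndependent n = (N : Poly (Fin n)) → (∀ R → eval (esymsᵒᵖ R) N ≡ 0ℤ) → N ≈ 𝟘

open Horner using (weaken; ⟦_⟧ₕ; horner; horner-sound)

horner-independent : ∀ {m} → EsymsIndependent m → (as : List (Poly (Fin m))) →
                     (∀ R → eval (esymsᵒᵖ R) ⟦ as ⟧ₕ ≡ 0ℤ) → ⟦ as ⟧ₕ ≈ 𝟘
horner-independent independent [] _ = ≈-refl
horner-independent {m} independent (a ∷ as) vanishes =
  ≈-trans (⊕-cong (subst-resp-≈ _ a≈𝟘) (≈-trans (⊗-cong ≈-refl as≈𝟘) (zeroʳ _))) (⊕-idˡ 𝟘)
  where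
  open PolyRing (Fin (suc m)) using (zeroʳ)
  open ≡-Reasoning

  eval-∷ : ∀ R → eval (esymsᵒᵖ R) ⟦ a ∷ as ⟧ₕ
               ≡ eval (λ j → esymsᵒᵖ R (suc j)) a +ᶻ esymsᵒᵖ R zero *ᶻ eval (esymsᵒᵖ R) ⟦ as ⟧ₕ
  eval-∷ R = cong (_+ᶻ _) (eval-subst _ (esymsᵒᵖ R) a)

  top-at-0∷ : ∀ (R : Vec ℤ m) → esymsᵒᵖ (0ℤ ∷ R) zero ≡ 0ℤ
  top-at-0∷ R = trans (esym-0∷ (toList R) (suc m)) (esym-beyond (toList R) (s≤s (ℕ.≤-reflexive (Vec.length-toList R))))

  a≈𝟘 : a ≈ 𝟘
  a≈𝟘 = independent a λ R → begin
      eval (esymsᵒᵖ R) a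
    ≡⟨ eval-cong (λ j → esym-0∷ (toList R) (m ∸ toℕ j)) a ⟨
      eval (λ j → esymsᵒᵖ (0ℤ ∷ R) (suc j)) a
    ≡⟨ ℤ.+-identityʳ _ ⟨
      eval (λ j → esymsᵒᵖ (0ℤ ∷ R) (suc j)) a +ᶻ 0ℤ *ᶻ eval (esymsᵒᵖ (0ℤ ∷ R)) ⟦ as ⟧ₕ
    ≡⟨ trans (eval-∷ (0ℤ ∷ R)) (cong (λ e → eval (λ j → esymsᵒᵖ (0ℤ ∷ R) (suc j)) a +ᶻ e *ᶻ eval (esymsᵒᵖ (0ℤ ∷ R)) ⟦ as ⟧ₕ)
                                    (top-at-0∷ R)) ⟨
      eval (esymsᵒᵖ (0ℤ ∷ R)) ⟦ a ∷ as ⟧ₕ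
    ≡⟨ vanishes (0ℤ ∷ R) ⟩
      0ℤ ∎

  top*as≡0 : ∀ R → esymsᵒᵖ R zero *ᶻ eval (esymsᵒᵖ R) ⟦ as ⟧ₕ ≡ 0ℤ
  top*as≡0 R = begin
      esymsᵒᵖ R zero *ᶻ eval (esymsᵒᵖ R) ⟦ as ⟧ₕ
    ≡⟨ ℤ.+-identityˡ _ ⟨
      0ℤ +ᶻ esymsᵒᵖ R zero *ᶻ eval (esymsᵒᵖ R) ⟦ as ⟧ₕ
    ≡⟨ cong (_+ᶻ _) (eval-resp-≈ _ a≈𝟘) ⟨
      eval (λ j → esymsᵒᵖ R (suc j)) a +ᶻ esymsᵒᵖ R zero *ᶻ eval (esymsᵒᵖ R) ⟦ as ⟧ₕ
    ≡⟨ trans (sym (eval-∷ R)) (vanishes R) ⟩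
      0ℤ ∎

  as-vanishing-off-hyperplanes : ∀ R → All (_≢ 0ℤ) R → eval (esymsᵒᵖ R) ⟦ as ⟧ₕ ≡ 0ℤ
  as-vanishing-off-hyperplanes R R≢0 =
    [ ⊥-elim ∘ esym-top≢0 R R≢0 , id ]′ (ℤ.i*j≡0⇒i≡0∨j≡0 _ (top*as≡0 R))

  as≈𝟘 : ⟦ as ⟧ₕ ≈ 𝟘
  as≈𝟘 = horner-independent independent as
    (dqs-vanishing (suc m) (dqs-eval (suc m) ⟦ as ⟧ₕ (λ k R → esymsᵒᵖ R k) (λ k → dqs-esym (suc m) (suc m ∸ toℕ k)))
                   as-vanishing-off-hyperplanes)

esyms-independent : ∀ n → EsymsIndependent n
esyms-independent zero N vanishes = Closed.eval≡0⇒≈𝟘 _ N (vanishes [])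
esyms-independent (suc m) N vanishes =
  ≈-trans (horner-sound N)
          (horner-independent (esyms-independent m) (horner N)
                              λ R → trans (sym (eval-resp-≈ _ (horner-sound N))) (vanishes R))

esymsᵒᵖ-separating : ∀ n (f g : Poly (Fin n)) → (∀ R → eval (esymsᵒᵖ R) f ≡ eval (esymsᵒᵖ R) g) → f ≈ g
esymsᵒᵖ-separating n f g agree =
  x∙y⁻¹≈ε⇒x≈y f g (esyms-independent n (f ⊕ ⊖ g) λ R → ℤ.i≡j⇒i-j≡0 (agree R))
  where open PolyRing (Fin n) using (x∙y⁻¹≈ε⇒x≈y)

reverseVars : ∀ {n} → Poly (Fin n) → Poly (Fin n)
reverseVars = subst (λ k → var (opposite k))

reverseVars-involutive : ∀ {n} (f : Poly (Fin n)) → reverseVars (reverseVars f) ≈ f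
reverseVars-involutive (var x) rewrite Fin.opposite-involutive x = ≈-refl
reverseVars-involutive 𝟘 = ≈-refl
reverseVars-involutive 𝟙 = ≈-refl
reverseVars-involutive (a ⊕ b) = ⊕-cong (reverseVars-involutive a) (reverseVars-involutive b)
reverseVars-involutive (a ⊗ b) = ⊗-cong (reverseVars-involutive a) (reverseVars-involutive b)
reverseVars-involutive (⊖ a) = ⊖-cong (reverseVars-involutive a)

eval-reverseVars : ∀ {n} (R : Vec ℤ n) f → eval (esymsᵒᵖ R) (reverseVars f) ≡ eval (esyms R) f
eval-reverseVars {n} R f = trans (eval-subst _ (esymsᵒᵖ R) f) (eval-cong (λ k → cong (esym (toList R)) (n∸opposite k)) f)
  where
  n∸opposite : ∀ k → n ∸ toℕ (opposite k) ≡ suc (toℕ k)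
  n∸opposite k = trans (cong (n ∸_) (Fin.opposite-prop k)) (ℕ.m∸[m∸n]≡n (Fin.toℕ<n k))

module AtRoots (p q : ℕ) (xs ys : List ℤ) (|xs|≤p : length xs ≤ p) (|ys|≤q : length ys ≤ q) where

  valuation : HE p q → ℤ
  valuation (inj₁ i) = esym xs (suc (toℕ i))
  valuation (inj₂ j) = esym ys (suc (toℕ j))

  eval-hh : ∀ i → eval valuation (hh p q i) ≡ esym xs i
  eval-hh zero = sym (esym-zero xs)
  eval-hh (suc i) with i <? p
  ... | yes i<p = cong (λ t → esym xs (suc t)) (Fin.toℕ-fromℕ< i<p)
  ... | no i≮p = sym (esym-beyond xs (s≤s (ℕ.≤-trans |xs|≤p (ℕ.≮⇒≥ i≮p))))

  eval-ee : ∀ j → eval valuation (ee p q j) ≡ esym ys j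
  eval-ee zero = sym (esym-zero ys)
  eval-ee (suc j) with j <? q
  ... | yes j<q = cong (λ t → esym ys (suc t)) (Fin.toℕ-fromℕ< j<q)
  ... | no j≮q = sym (esym-beyond ys (s≤s (ℕ.≤-trans |ys|≤q (ℕ.≮⇒≥ j≮q))))

  eval-conv : ∀ i j → eval valuation (conv p q i j) ≡ convolve (esym xs) (esym ys) i j
  eval-conv zero j = cong₂ _*ᶻ_ (eval-hh zero) (eval-ee j)
  eval-conv (suc i) j = cong₂ _+ᶻ_ (eval-conv i (suc j)) (cong₂ _*ᶻ_ (eval-hh (suc i)) (eval-ee j))

  eval-cimg : ∀ k → eval valuation (cimg p q k) ≡ esym (xs ++ ys) k
  eval-cimg k = trans (eval-conv k 0) (sym (esym-++ xs ys k))

eval-φ-at-roots : ∀ {n p q} → n ≤ p + q → (R : Vec ℤ n) →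
                  Σ (HE p q → ℤ) λ ρ → ∀ f → eval ρ (φ n p q f) ≡ eval (esyms R) f
eval-φ-at-roots {n} {p} {q} n≤p+q R = valuation , λ f → trans (eval-subst _ valuation f) (eval-cong eval-c f)
  where
  xs = toList R
  |take|≤p : length (take p xs) ≤ p
  |take|≤p = ℕ.≤-trans (ℕ.≤-reflexive (List.length-take p xs)) (ℕ.m⊓n≤m p (length xs))
  |drop|≤q : length (drop p xs) ≤ q
  |drop|≤q = ℕ.≤-trans (ℕ.≤-reflexive (List.length-drop p xs))
    (ℕ.m≤n+o⇒m∸n≤o (length xs) p (ℕ.≤-trans (ℕ.≤-reflexive (Vec.length-toList R)) n≤p+q))
  open AtRoots p q (take p xs) (drop p xs) |take|≤p |drop|≤q
  eval-c : ∀ k → eval valuation (cimg p q (suc (toℕ k))) ≡ esyms R k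
  eval-c k = trans (eval-cimg _) (cong (λ ys → esym ys (suc (toℕ k))) (List.take++drop≡id p xs))

lemma14p1 : (n p q : ℕ) → 1 ≤ n → 1 ≤ p → 1 ≤ q → n ≤ p + q →
              (f g : Poly (Fin n)) → φ n p q f ≈ φ n p q g → f ≈ g
lemma14p1 n p q _ _ _ n≤p+q f g φf≈φg = begin
    f                            ≈⟨ reverseVars-involutive f ⟨
    reverseVars (reverseVars f)  ≈⟨ subst-resp-≈ _ reversed-agree ⟩
    reverseVars (reverseVars g)  ≈⟨ reverseVars-involutive g ⟩
    g                            ∎
  where
  open PolyRing (Fin n) using (begin_; step-≈-⟩; step-≈-⟨; _∎)

  esyms-agree : ∀ R → eval (esyms R) f ≡ eval (esyms R) g
  esyms-agree R = let (ρ , eval-φ) = eval-φ-at-roots n≤p+q R in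
    trans (sym (eval-φ f)) (trans (eval-resp-≈ ρ φf≈φg) (eval-φ g))

  reversed-agree : reverseVars f ≈ reverseVars g
  reversed-agree = esymsᵒᵖ-separating n _ _ λ R →
    trans (eval-reverseVars R f) (trans (esyms-agree R) (sym (eval-reverseVars R g)))
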